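{- Let $\mathcal{P}$ be a chiral $n$-polytope such that $X(\mathcal{P})$ is infinite, and let $\mathcal{Q}$ be a finite chiral or directly regular $n$-polytope. Then $X(\mathcal{P}\diamond\mathcal{Q})$ is infinite.
   Context: All polytopes are abstract polytopes. A regular polytope is directly regular if its rotation group $\Gamma^+(\mathcal{P})$, generated by $\sigma_i=\rho_{i-1}\rho_i$ ($\rho_0,\dots,\rho_{n-1}$ the standard generating involutions relative to a base flag), has index $2$ in the automorphism group. A polytope is chiral if its automorphism group has two orbits on flags, adjacent flags lying in distinct orbits; then $\Gamma^+(\mathcal{P})$ is the full automorphism group, generated by standard rotations $\sigma_1,\dots,\sigma_{n-1}$. Let $W^+=\langle \sigma_1,\dots,\sigma_{n-1}\mid (\sigma_i\cdots\sigma_j)^2=1,\ 1\le i<j\le n-1\rangle$; each such $\Gamma^+(\mathcal{P})$ equals $W^+/M$ for a normal subgroup $M$, generators corresponding. Let $w\mapsto\overline{w}$ be the automorphism of $W^+$ with $\sigma_1\mapsto\sigma_1^{ -1}$, $\sigma_2\mapsto\sigma_1^2\sigma_2$, $\sigma_j\mapsto\sigma_j$ ($j\ge3$). Mix: if $\Gamma^+(\mathcal{P})=W^+/M$ and $\Gamma^+(\mathcal{Q})=W^+/K$, the mix $\mathcal{P}\diamond\mathcal{Q}$ is the (flag-connected pre-)polytope whose rotation group is the subgroup of $\Gamma^+(\mathcal{P})\times\Gamma^+(\mathcal{Q})$ generated by $(\sigma_i,\sigma_i')$, isomorphic to $W^+/(M\cap K)$. Chirality group: for rotation group $W^+/N$,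 $X=N\overline{N}/N$, the kernel of the natural epimorphism $W^+/N\to W^+/(N\overline N)$ (isomorphic to $N/(N\cap\overline N)$). -}

module Defs where

open import Level using (0ℓ)
open import Data.Nat as ℕ using (ℕ; zero; suc)
open import Data.Fin as Fin using (Fin; zero; suc; toℕ; inject₁; fromℕ)
open import Data.List using (List; []; _∷_; _++_)
open import Data.List.Relation.Unary.Any using (Any)
open import Data.List.Membership.Propositional using (_∈_)
open import Data.Product using (Σ; ∃; ∃-syntax; _×_; _,_)
open import Data.Sum using (_⊎_)
open import Relation.Nullary using (¬_)
open import Relation.Binary.PropositionalEquality using (_≡_; _≢_)
open import Relation.Binary.Structures using (IsPartialOrder)

-- Ranked posets.  Ranks -1,0,…,n are encoded as Fin (n+2):
-- the element r : Fin (suc (suc n)) stands for rank (toℕ r) - 1.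

record RankedPoset (n : ℕ) : Set₁ where
  field
    Face           : Set
    _≼_            : Face → Face → Set
    isPartialOrder : IsPartialOrder _≡_ _≼_
    rank           : Face → Fin (suc (suc n))

module _ {n : ℕ} (P : RankedPoset n) where
  open RankedPoset P

  record Flag : Set where
    field
      face    : Fin (suc (suc n)) → Face
      rank-ok : ∀ j → rank (face j) ≡ j
      chain   : ∀ j k → j Fin.≤ k → face j ≼ face k
  open Flag public

  -- position (in Fin (n+2)) of the proper rank i ∈ {0,…,n-1}
  pos : Fin n → Fin (suc (suc n))
  pos i = suc (inject₁ i)

  Adj : Fin n → Flag → Flag → Set
  Adj i Φ Ψ = (face Φ (pos i) ≢ face Ψ (pos i))
            × (∀ j → j ≢ pos i → face Φ j ≡ face Ψ j)

  data Walk (S : Flag → Set) : Flag → Flag → Set where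
    stop : ∀ {Φ Ψ} → (∀ j → face Φ j ≡ face Ψ j) → Walk S Φ Ψ
    step : ∀ {Φ Λ Ψ} (i : Fin n) → Adj i Φ Λ → S Λ → Walk S Λ Ψ → Walk S Φ Ψ

  StronglyFlagConnected : Set
  StronglyFlagConnected =
    ∀ Φ Ψ → Walk (λ Λ → ∀ j → face Φ j ≡ face Ψ j → face Λ j ≡ face Φ j) Φ Ψ

  Between : Face → Face → Face → Set
  Between x z y = x ≼ z × z ≼ y × x ≢ z × z ≢ y

  record IsPolytope : Set where
    field
      rank-mono   : ∀ {x y} → x ≼ y → x ≢ y → rank x Fin.< rank y
      least       : Face
      least-rank  : rank least ≡ zero
      least-min   : ∀ x → least ≼ x
      greatest    : Face
      greatest-rank : rank greatest ≡ fromℕ (suc n)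
      greatest-max  : ∀ x → x ≼ greatest
      no-gaps     : ∀ {x y} → x ≼ y → suc (suc (toℕ (rank x))) ℕ.≤ toℕ (rank y)
                    → ∃[ z ] Between x z y
      diamond     : ∀ {x y} → x ≼ y → toℕ (rank y) ≡ suc (suc (toℕ (rank x)))
                    → ∃[ z₁ ] ∃[ z₂ ] (Between x z₁ y × Between x z₂ y × z₁ ≢ z₂
                        × (∀ z → Between x z y → z ≡ z₁ ⊎ z ≡ z₂))
      strongly-flag-connected : StronglyFlagConnected

  record Aut : Set where
    field
      to      : Face → Face
      from    : Face → Face
      from-to : ∀ x → from (to x) ≡ x
      to-from : ∀ x → to (from x) ≡ x
      mono    : ∀ {x y} → x ≼ y → to x ≼ to y
      mono⁻   : ∀ {x y} → to x ≼ to y → x ≼ y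
  open Aut public

  MapsFlag : Aut → Flag → Flag → Set
  MapsFlag α Φ Ψ = ∀ j → to α (face Φ j) ≡ face Ψ j

  SameOrbit : Flag → Flag → Set
  SameOrbit Φ Ψ = ∃[ α ] MapsFlag α Φ Ψ

  Regular : Set
  Regular = ∀ Φ Ψ → SameOrbit Φ Ψ

  Chiral : Set
  Chiral = (∃[ Φ ] ∃[ Ψ ] ¬ SameOrbit Φ Ψ)
         × (∀ i Φ Φ' Ψ → Adj i Φ Φ' → SameOrbit Φ Ψ ⊎ SameOrbit Φ' Ψ)
         × (∀ i Φ Ψ → Adj i Φ Ψ → ¬ SameOrbit Φ Ψ)

  FinitePolytope : Set
  FinitePolytope = ∃[ L ] (∀ (x : Face) → x ∈ L)

-- Words in the generators σ₁,…,σₘ of W⁺ and their inverses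
-- (generator index k : Fin m stands for σ_{k+1}).

data Letter (m : ℕ) : Set where
  gen : Fin m → Letter m
  inv : Fin m → Letter m

Word : ℕ → Set
Word m = List (Letter m)

-- the automorphism w ↦ w̄ of W⁺ lifted to words:
-- σ₁ ↦ σ₁⁻¹, σ₂ ↦ σ₁²σ₂, σⱼ ↦ σⱼ (j ≥ 3)
barL : ∀ {m} → Letter m → Word m
barL {suc m} (gen zero)          = inv zero ∷ []
barL {suc m} (inv zero)          = gen zero ∷ []
barL {suc (suc m)} (gen (suc zero)) = gen zero ∷ gen zero ∷ gen (suc zero) ∷ []
barL {suc (suc m)} (inv (suc zero)) = inv (suc zero) ∷ inv zero ∷ inv zero ∷ []
barL (gen (suc (suc k)))         = gen (suc (suc k)) ∷ []
barL (inv (suc (suc k)))         = inv (suc (suc k)) ∷ []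

bar : ∀ {m} → Word m → Word m
bar []      = []
bar (l ∷ w) = barL l ++ bar w

module _ {m : ℕ} (P : RankedPoset (suc m)) where
  open RankedPoset P

  -- σ : Fin m → Aut P are the standard rotations relative to the base
  -- flag Φ: σᵢ maps Φ to Φ^{i-1,i} (first the (i-1)-adjacent flag,
  -- then its i-adjacent flag), so that σᵢ = ρ_{i-1} ρᵢ in the regular case.
  StdRotations : Flag P → (Fin m → Aut P) → Set
  StdRotations Φ σ = ∀ k → ∃[ Ψ ] ∃[ Λ ]
    (Adj P (inject₁ k) Φ Ψ × Adj P (suc k) Ψ Λ × MapsFlag P (σ k) Φ Λ)

  evalL : (Fin m → Aut P) → Letter m → Face → Face
  evalL σ (gen k) = to (σ k)
  evalL σ (inv k) = from (σ k)

  eval : (Fin m → Aut P) → Word m → Face → Face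
  eval σ []      x = x
  eval σ (l ∷ w) x = evalL σ l (eval σ w x)

  InRot : (Fin m → Aut P) → Aut P → Set
  InRot σ α = ∃[ w ] (∀ x → to α x ≡ eval σ w x)

  -- directly regular: regular, and Γ⁺(P) has index 2 in Γ(P)
  DirectlyRegular : (Fin m → Aut P) → Set
  DirectlyRegular σ = Regular P
    × (∃[ α ] ¬ InRot σ α)
    × (∀ α β → ¬ InRot σ α → ¬ InRot σ β
         → ∃[ w ] (∀ x → from β (to α x) ≡ eval σ w x))

  -- the normal subgroup M with Γ⁺(P) = W⁺/M (as a set of words)
  Ker : (Fin m → Aut P) → Word m → Set
  Ker σ w = ∀ x → eval σ w x ≡ x

  SameIn : (Fin m → Aut P) → Word m → Word m → Set
  SameIn σ u v = ∀ x → eval σ u x ≡ eval σ v x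

-- Chirality group X = N N̄ / N of a rotation group W⁺/N, where N is given
-- as a set of words and E is equality in W⁺/N.

InNNbar : ∀ {m} → (Word m → Set) → (Word m → Word m → Set) → Word m → Set
InNNbar N E x = ∃[ u ] ∃[ w ] (N u × N w × E x (u ++ bar w))

XFinite : ∀ {m} → (Word m → Set) → (Word m → Word m → Set) → Set
XFinite N E = ∃[ L ] (∀ x → InNNbar N E x → Any (E x) L)

XInfinite : ∀ {m} → (Word m → Set) → (Word m → Word m → Set) → Set
XInfinite N E = ¬ XFinite N E

XInfiniteP : ∀ {m} (P : RankedPoset (suc m)) → (Fin m → Aut P) → Set
XInfiniteP P σ = XInfinite (Ker P σ) (SameIn P σ)

-- chirality group of the mix P ◇ Q, whose rotation group is
-- W⁺/(M ∩ K) = ⟨(σᵢ, σᵢ')⟩ ≤ Γ⁺(P) × Γ⁺(Q)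
XInfiniteMix : ∀ {m} (P Q : RankedPoset (suc m))
  → (Fin m → Aut P) → (Fin m → Aut Q) → Set
XInfiniteMix P Q σ τ =
  XInfinite (λ w → Ker P σ w × Ker Q τ w)
            (λ u v → SameIn P σ u v × SameIn Q τ u v)

-- Write Γ⁺(P) = W⁺/M and Γ⁺(Q) = W⁺/K, so that Γ⁺(P ◇ Q) = W⁺/(M ∩ K).
-- Suppose, for a contradiction, that finitely many words l ∈ Lm represent
-- X(P ◇ Q), i.e. every element of (M ∩ K)(M ∩ K)‾ modulo M ∩ K.
-- Since Q is finite, a word acts on the faces of Q in one of finitely many
-- ways, so (classically, which suffices since the goal is a negation) some
-- finite list R ⊆ M meets every class of M modulo K.  Now let x = u w̄ with
-- u, w ∈ M, and pick r ∈ R with w ≡ r mod K.  Then w r⁻¹ ∈ M ∩ K, so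
-- (w r⁻¹)‾ ≡ l mod M ∩ K for some l ∈ Lm, and hence x ≡ w̄ = (w r⁻¹)‾ r̄ ≡ l r̄
-- mod M.  Thus the finitely many words l r̄ (l ∈ Lm, r ∈ R) represent X(P).
module Submission where

open import Defs
open import Data.Nat using (ℕ; suc)
open import Data.Fin using (Fin; zero; suc)
open import Data.Sum using (_⊎_)
open import Data.Empty using (⊥-elim)
open import Data.List using (List; []; _∷_; _++_; map; cartesianProductWith)
open import Data.List.Properties using (++-assoc; ++-identityʳ; ∷-injective)
open import Data.List.Relation.Unary.Any as Any using (Any; here; there)
open import Data.List.Relation.Unary.Any.Properties using (cartesianProductWith⁺)
open import Data.List.Membership.Propositional using (_∈_; find)
open import Data.Product using (∃-syntax; _×_; _,_; proj₁; proj₂)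
open import Function using (_∘_)
open import Effect.Monad using (RawMonad)
open import Relation.Nullary.Decidable using (Dec; yes; no; ¬¬-excluded-middle)
open import Relation.Nullary.Negation using (¬_; ¬¬-map; ¬¬-Monad)
open import Relation.Binary.PropositionalEquality
open ≡-Reasoning

choices : {A B : Set} → List B → List A → List (List B)
choices ys []       = [] ∷ []
choices ys (x ∷ xs) = cartesianProductWith _∷_ ys (choices ys xs)

map∈choices : {A B : Set} {ys : List B} (f : A → B) → (∀ a → f a ∈ ys)
  → ∀ xs → map f xs ∈ choices ys xs
map∈choices f f∈ []       = here refl
map∈choices f f∈ (x ∷ xs) =
  cartesianProductWith⁺ _∷_ (λ { refl refl → refl }) (f∈ x) (map∈choices f f∈ xs)

map-agree : {A B : Set} {f g : A → B} {x : A} (xs : List A)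
  → map f xs ≡ map g xs → x ∈ xs → f x ≡ g x
map-agree (y ∷ xs) eq (here refl) = proj₁ (∷-injective eq)
map-agree (y ∷ xs) eq (there x∈) = map-agree xs (proj₂ (∷-injective eq)) x∈

Representatives : {A : Set} → (A → Set) → (A → A → Set) → List A → Set
Representatives S _~_ R = ∀ a → S a → Any (λ r → S r × a ~ r) R

-- Classical: for each value t one decides (under ¬¬) whether S meets g⁻¹(t).
representatives : {A T : Set} (S : A → Set) (g : A → T) (Ts : List T)
  → (∀ a → S a → g a ∈ Ts) → ¬ ¬ (∃[ R ] Representatives S (λ a b → g a ≡ g b) R)
representatives {A} {T} S g Ts g∈Ts =
  ¬¬-map (λ (R , rep) → R , λ a Sa → rep a Sa (g∈Ts a Sa)) (over Ts)
  where
  open RawMonad ¬¬-Monad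

  RepresentsOver : List T → List A → Set
  RepresentsOver ts R = ∀ a → S a → g a ∈ ts → Any (λ r → S r × g a ≡ g r) R

  over : ∀ ts → ¬ ¬ (∃[ R ] RepresentsOver ts R)
  over []       = pure ([] , λ _ _ ())
  over (t ∷ ts) = do
    R,rep ← over ts
    hit? ← ¬¬-excluded-middle
    pure (extend hit? R,rep)
    where
    extend : Dec (∃[ a ] (S a × g a ≡ t)) → ∃[ R ] RepresentsOver ts R
      → ∃[ R ] RepresentsOver (t ∷ ts) R
    extend (yes (a , Sa , ga≡t)) (R , rep) = a ∷ R , λ where
      b Sb (here gb≡t) → here (Sa , trans gb≡t (sym ga≡t))
      b Sb (there gb∈) → there (rep b Sb gb∈)
    extend (no ∄a) (R , rep) = R , λ where
      b Sb (here gb≡t) → ⊥-elim (∄a (b , Sb , gb≡t))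
      b Sb (there gb∈) → rep b Sb gb∈

flipL : ∀ {m} → Letter m → Letter m
flipL (gen k) = inv k
flipL (inv k) = gen k

invW : ∀ {m} → Word m → Word m
invW []      = []
invW (l ∷ w) = invW w ++ flipL l ∷ []

invW-++ : ∀ {m} (u v : Word m) → invW (u ++ v) ≡ invW v ++ invW u
invW-++ []      v = sym (++-identityʳ (invW v))
invW-++ (l ∷ u) v = begin
  invW (u ++ v) ++ flipL l ∷ []      ≡⟨ cong (_++ flipL l ∷ []) (invW-++ u v) ⟩
  (invW v ++ invW u) ++ flipL l ∷ [] ≡⟨ ++-assoc (invW v) (invW u) (flipL l ∷ []) ⟩
  invW v ++ invW (l ∷ u)             ∎

bar-++ : ∀ {m} (u v : Word m) → bar (u ++ v) ≡ bar u ++ bar v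
bar-++ []      v = refl
bar-++ (l ∷ u) v = begin
  barL l ++ bar (u ++ v)     ≡⟨ cong (barL l ++_) (bar-++ u v) ⟩
  barL l ++ (bar u ++ bar v) ≡⟨ sym (++-assoc (barL l) (bar u) (bar v)) ⟩
  (barL l ++ bar u) ++ bar v ∎

barL-flipL : ∀ {m} (l : Letter m) → barL (flipL l) ≡ invW (barL l)
barL-flipL {suc m}       (gen zero)          = refl
barL-flipL {suc m}       (inv zero)          = refl
barL-flipL {suc (suc m)} (gen (suc zero))    = refl
barL-flipL {suc (suc m)} (inv (suc zero))    = refl
barL-flipL               (gen (suc (suc k))) = refl
barL-flipL               (inv (suc (suc k))) = refl

bar-invW : ∀ {m} (w : Word m) → bar (invW w) ≡ invW (bar w)
bar-invW []      = refl
bar-invW (l ∷ w) = begin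
  bar (invW w ++ flipL l ∷ [])         ≡⟨ bar-++ (invW w) (flipL l ∷ []) ⟩
  bar (invW w) ++ barL (flipL l) ++ [] ≡⟨ cong₂ _++_ (bar-invW w) (++-identityʳ (barL (flipL l))) ⟩
  invW (bar w) ++ barL (flipL l)       ≡⟨ cong (invW (bar w) ++_) (barL-flipL l) ⟩
  invW (bar w) ++ invW (barL l)        ≡⟨ sym (invW-++ (barL l) (bar w)) ⟩
  invW (barL l ++ bar w)               ∎

module Action {m : ℕ} (P : RankedPoset (suc m)) (σ : Fin m → Aut P) where
  open RankedPoset P using (Face)

  act : Word m → Face → Face
  act = eval P σ

  actL : Letter m → Face → Face
  actL = evalL P σ

  act-++ : ∀ u v x → act (u ++ v) x ≡ act u (act v x)
  act-++ []      v x = refl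
  act-++ (l ∷ u) v x = cong (actL l) (act-++ u v x)

  flipL-cancelˡ : ∀ l x → actL (flipL l) (actL l x) ≡ x
  flipL-cancelˡ (gen k) x = from-to (σ k) x
  flipL-cancelˡ (inv k) x = to-from (σ k) x

  flipL-cancelʳ : ∀ l x → actL l (actL (flipL l) x) ≡ x
  flipL-cancelʳ (gen k) x = to-from (σ k) x
  flipL-cancelʳ (inv k) x = from-to (σ k) x

  invW-cancelˡ : ∀ w x → act (invW w) (act w x) ≡ x
  invW-cancelˡ []      x = refl
  invW-cancelˡ (l ∷ w) x = begin
    act (invW w ++ flipL l ∷ []) (actL l (act w x))   ≡⟨ act-++ (invW w) (flipL l ∷ []) _ ⟩
    act (invW w) (actL (flipL l) (actL l (act w x))) ≡⟨ cong (act (invW w)) (flipL-cancelˡ l _) ⟩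
    act (invW w) (act w x)                           ≡⟨ invW-cancelˡ w x ⟩
    x                                                ∎

  invW-cancelʳ : ∀ w x → act w (act (invW w) x) ≡ x
  invW-cancelʳ []      x = refl
  invW-cancelʳ (l ∷ w) x = begin
    actL l (act w (act (invW w ++ flipL l ∷ []) x))   ≡⟨ cong (actL l ∘ act w) (act-++ (invW w) (flipL l ∷ []) x) ⟩
    actL l (act w (act (invW w) (actL (flipL l) x))) ≡⟨ cong (actL l) (invW-cancelʳ w _) ⟩
    actL l (actL (flipL l) x)                        ≡⟨ flipL-cancelʳ l x ⟩
    x                                                ∎

  quotient-trivial : ∀ w r → SameIn P σ w r → Ker P σ (w ++ invW r)
  quotient-trivial w r w≈r x = begin
    act (w ++ invW r) x    ≡⟨ act-++ w (invW r) x ⟩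
    act w (act (invW r) x) ≡⟨ w≈r _ ⟩
    act r (act (invW r) x) ≡⟨ invW-cancelʳ r x ⟩
    x                      ∎

  bar-factor : ∀ w r → SameIn P σ (bar (w ++ invW r) ++ bar r) (bar w)
  bar-factor w r x = begin
    act (bar (w ++ invW r) ++ bar r) x               ≡⟨ act-++ (bar (w ++ invW r)) (bar r) x ⟩
    act (bar (w ++ invW r)) (act (bar r) x)          ≡⟨ cong (λ v → act v (act (bar r) x)) bar-quotient ⟩
    act (bar w ++ invW (bar r)) (act (bar r) x)      ≡⟨ act-++ (bar w) (invW (bar r)) _ ⟩
    act (bar w) (act (invW (bar r)) (act (bar r) x)) ≡⟨ cong (act (bar w)) (invW-cancelˡ (bar r) x) ⟩
    act (bar w) x                                    ∎
    where
    bar-quotient : bar (w ++ invW r) ≡ bar w ++ invW (bar r)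
    bar-quotient = trans (bar-++ w (invW r)) (cong (bar w ++_) (bar-invW r))

-- A finite polytope Q has only finitely many faces, so a word is determined
-- modulo K by its (tabulated) action on them; hence every set S of words
-- has, classically, a finite system of representatives modulo K.
representatives-mod-K : ∀ {m} (Q : RankedPoset (suc m)) (τ : Fin m → Aut Q)
  → FinitePolytope Q → (S : Word m → Set)
  → ¬ ¬ (∃[ R ] Representatives S (SameIn Q τ) R)
representatives-mod-K {m} Q τ (L , L-complete) S =
  ¬¬-map (λ (R , rep) → R , λ w Sw → Any.map (same-tabulation {w}) (rep w Sw))
    (representatives S tabulate (choices L L)
      (λ w _ → map∈choices (eval Q τ w) (λ x → L-complete (eval Q τ w x)) L))
  where
  tabulate : Word m → List (RankedPoset.Face Q)
  tabulate w = map (eval Q τ w) L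

  same-tabulation : ∀ {w r} → S r × tabulate w ≡ tabulate r → S r × SameIn Q τ w r
  same-tabulation {w} (Sr , w≡r) = Sr , λ x → map-agree L w≡r (L-complete x)

cover-transfer : ∀ {m} (P Q : RankedPoset (suc m)) (σ : Fin m → Aut P) (τ : Fin m → Aut Q)
  → (R : List (Word m)) → Representatives (Ker P σ) (SameIn Q τ) R
  → XFinite (λ w → Ker P σ w × Ker Q τ w) (λ u v → SameIn P σ u v × SameIn Q τ u v)
  → XFinite (Ker P σ) (SameIn P σ)
cover-transfer P Q σ τ R rep (Lm , Lm-covers) =
  cartesianProductWith (λ l r → l ++ bar r) Lm R , covered
  where
  module AP = Action P σ
  module AQ = Action Q τ

  covered : ∀ x → InNNbar (Ker P σ) (SameIn P σ) x
    → Any (SameIn P σ x) (cartesianProductWith (λ l r → l ++ bar r) Lm R)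
  covered x (u , w , Mu , Mw , x≈uw̄) with find (rep w Mw)
  ... | r , r∈R , Mr , w≈r = cartesianProductWith⁺ (λ l r → l ++ bar r) (λ {l} → agrees l) q̄-cover r∈R
    where
    q : Word _
    q = w ++ invW r

    Mq : Ker P σ q
    Mq = AP.quotient-trivial w r (λ y → trans (Mw y) (sym (Mr y)))

    Kq : Ker Q τ q
    Kq = AQ.quotient-trivial w r w≈r

    -- q̄ = 1 · q̄ with 1, q ∈ M ∩ K lies in X(P ◇ Q), so it is covered by some l ∈ Lm
    q̄-cover : Any (λ l → SameIn P σ (bar q) l × SameIn Q τ (bar q) l) Lm
    q̄-cover = Lm-covers (bar q)
      ([] , q , ((λ _ → refl) , (λ _ → refl)) , (Mq , Kq) , ((λ _ → refl) , (λ _ → refl)))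

    agrees : ∀ l {r'} → SameIn P σ (bar q) l × SameIn Q τ (bar q) l → r ≡ r'
      → SameIn P σ x (l ++ bar r')
    agrees l (q̄≈l , _) refl y = begin
      AP.act x y                        ≡⟨ x≈uw̄ y ⟩
      AP.act (u ++ bar w) y             ≡⟨ AP.act-++ u (bar w) y ⟩
      AP.act u (AP.act (bar w) y)       ≡⟨ Mu _ ⟩
      AP.act (bar w) y                  ≡⟨ sym (AP.bar-factor w r y) ⟩
      AP.act (bar q ++ bar r) y         ≡⟨ AP.act-++ (bar q) (bar r) y ⟩
      AP.act (bar q) (AP.act (bar r) y) ≡⟨ q̄≈l _ ⟩
      AP.act l (AP.act (bar r) y)       ≡⟨ sym (AP.act-++ l (bar r) y) ⟩
      AP.act (l ++ bar r) y             ∎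

theorem4p9 : (m : ℕ) (P Q : RankedPoset (suc m))
    → IsPolytope P → IsPolytope Q
    → (Φ : Flag P) (σ : Fin m → Aut P) → StdRotations P Φ σ
    → (Ψ : Flag Q) (τ : Fin m → Aut Q) → StdRotations Q Ψ τ
    → Chiral P → XInfiniteP P σ
    → FinitePolytope Q → (Chiral Q ⊎ DirectlyRegular Q τ)
    → XInfiniteMix P Q σ τ
theorem4p9 m P Q _ _ _ σ _ _ τ _ _ X-P-infinite Q-finite _ X-mix-finite =
  representatives-mod-K Q τ Q-finite (Ker P σ) λ (R , R-represents) →
    X-P-infinite (cover-transfer P Q σ τ R R-represents X-mix-finite)
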